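{- Let $m,n\geq0$ and $L=\mathrm{Log}\,\mathcal{F}(m,n)$. If $n>m$, then $L$ is pretransitive and $\mathrm{tr}(L)=n-1$. If $n\leq m$, then $L$ is not pretransitive.
   Context: Modal formulas: variables, $\bot,\top$, Boolean connectives, unary $\Diamond$; $\Diamond^0\varphi=\varphi$, $\Diamond^{i+1}\varphi=\Diamond\Diamond^i\varphi$, $\Diamond^{\le m}\varphi=\bigvee_{i=0}^m\Diamond^i\varphi$. Frames $(W,R)$ with $\Diamond\varphi$ true at $w$ iff true at some $R$-successor; $\mathrm{Log}\,\mathcal{C}$ is the set of formulas valid in all frames of $\mathcal{C}$. $R^0$ is the identity, $R^{i+1}=R^i\circ R$. $\mathcal{F}(m,n)$ is the class of frames with $R^n\subseteq R^m$. A logic $L$ is pretransitive if it contains $\Diamond^{k+1}p\to\Diamond^{\le k}p$ for some $k\ge0$; $\mathrm{tr}(L)$ is the least such $k$. -}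

module Defs where

open import Level using (Level; suc; zero)
open import Data.Nat using (ℕ) renaming (zero to z; suc to s)
open import Data.Product using (Σ; _×_; ∃)
open import Data.Empty using (⊥)
open import Data.Unit using (⊤)
open import Relation.Nullary using (¬_)
open import Relation.Binary.PropositionalEquality using (_≡_)

data Fm : Set where
  var  : ℕ → Fm
  ⊥ᶠ   : Fm
  ⊤ᶠ   : Fm
  ¬ᶠ_  : Fm → Fm
  _∧ᶠ_ : Fm → Fm → Fm
  _∨ᶠ_ : Fm → Fm → Fm
  _⇒ᶠ_ : Fm → Fm → Fm
  ◇_   : Fm → Fm

◇^ : ℕ → Fm → Fm
◇^ z φ = φ
◇^ (s i) φ = ◇ (◇^ i φ)

◇≤ : ℕ → Fm → Fm
◇≤ z φ = ◇^ z φ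
◇≤ (s m) φ = ◇≤ m φ ∨ᶠ ◇^ (s m) φ

record Frame : Set₁ where
  field
    W : Set
    R : W → W → Set

-- Kripke semantics, classical: implemented via the Gödel–Gentzen
-- (double-negation) reading so that truth values are ¬¬-stable and
-- the logic of a class is the classical one.
module _ (F : Frame) where
  open Frame F

  Valuation : Set₁
  Valuation = ℕ → W → Set

  Sat : Valuation → W → Fm → Set
  Sat V w (var p)   = ¬ ¬ V p w
  Sat V w ⊥ᶠ        = ⊥
  Sat V w ⊤ᶠ        = ⊤
  Sat V w (¬ᶠ φ)    = ¬ Sat V w φ
  Sat V w (φ ∧ᶠ ψ)  = Sat V w φ × Sat V w ψ
  Sat V w (φ ∨ᶠ ψ)  = ¬ (¬ Sat V w φ × ¬ Sat V w ψ)
  Sat V w (φ ⇒ᶠ ψ)  = Sat V w φ → Sat V w ψ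
  Sat V w (◇ φ)     = ¬ (∀ v → R w v → ¬ Sat V v φ)

  ValidIn : Fm → Set₁
  ValidIn φ = ∀ (V : Valuation) (w : W) → Sat V w φ

  Rpow : ℕ → W → W → Set
  Rpow z x y = x ≡ y
  Rpow (s i) x y = Σ W λ u → Rpow i x u × R u y

Class : Set₁
Class = Frame → Set

Log : Class → Fm → Set₁
Log C φ = ∀ (F : Frame) → C F → ValidIn F φ

𝓕 : ℕ → ℕ → Class
𝓕 m n F = ∀ x y → Rpow F n x y → Rpow F m x y

Logic : Set₂
Logic = Fm → Set₁

ptAx : ℕ → Fm
ptAx k = ◇^ (s k) (var z) ⇒ᶠ ◇≤ k (var z)

Pretransitive : Logic → Set₁
Pretransitive L = ∃ λ k → L (ptAx k)

open import Data.Nat using (_≤_)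
IsTr : Logic → ℕ → Set₁
IsTr L k = L (ptAx k) × (∀ j → L (ptAx j) → k ≤ j)

-- Soundness: if R^{k+1} ⊆ R^m with m ≤ k, then any ◇^{k+1}-witness is already a ◇^m-witness.
-- Optimality and non-pretransitivity come from two countermodels on ℕ with the valuation
-- p = {t}: a point 0 that reaches t in k+1 steps but in no fewer, inside a frame of the class.
-- For n ≤ m the frame x R y ⇔ y ≤ x+1 lies in 𝓕(m,n) and defeats every k (t = k+1);
-- for k+1 < n the finite chain 0 → 1 → ⋯ → k+1 has no R-path of length n at all.
module Submission where

open import Defs
open import Data.Nat using (ℕ; _<_; _≤_; _∸_; zero; suc; _+_; z≤n; s≤s; _≟_; _≤?_)
open import Data.Nat.Properties
open import Data.Product using (_×_; _,_; proj₁; proj₂)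
open import Data.Unit using (tt)
open import Data.Empty using (⊥-elim)
open import Relation.Nullary using (¬_; yes; no)
open import Relation.Nullary.Negation using (Stable; negated-stable; contradiction)
open import Relation.Binary.PropositionalEquality using (_≡_; refl; sym; trans; subst; cong)

◇^-suc : ∀ i φ → ◇^ (suc i) φ ≡ ◇^ i (◇ φ)
◇^-suc zero    φ = refl
◇^-suc (suc i) φ = cong ◇_ (◇^-suc i φ)

module _ (F : Frame) (V : Valuation F) where
  -- Sat is a double-negation translation, so the soundness proof may argue by contradiction.
  Sat-stable : ∀ x φ → Stable (Sat F V x φ)
  Sat-stable x (var p)  = negated-stable
  Sat-stable x ⊥ᶠ       h = h (λ b → b)
  Sat-stable x ⊤ᶠ       h = tt
  Sat-stable x (¬ᶠ φ)   = negated-stable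
  Sat-stable x (φ ∧ᶠ ψ) h =
    Sat-stable x φ (λ ¬φ → h (λ s → ¬φ (proj₁ s))) , Sat-stable x ψ (λ ¬ψ → h (λ s → ¬ψ (proj₂ s)))
  Sat-stable x (φ ∨ᶠ ψ) = negated-stable
  Sat-stable x (φ ⇒ᶠ ψ) h a = Sat-stable x ψ (λ ¬ψ → h (λ f → ¬ψ (f a)))
  Sat-stable x (◇ φ)    = negated-stable

  ◇^-intro : ∀ i {x y} φ → Rpow F i x y → Sat F V y φ → Sat F V x (◇^ i φ)
  ◇^-intro zero    φ refl         sφ = sφ
  ◇^-intro (suc i) {x} φ (u , xRⁱu , uRy) sφ =
    subst (Sat F V x) (sym (◇^-suc i φ)) (◇^-intro i (◇ φ) xRⁱu (λ h → h _ uRy sφ))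

  ◇^-elim : ∀ i {x} φ → (∀ y → Rpow F i x y → ¬ Sat F V y φ) → ¬ Sat F V x (◇^ i φ)
  ◇^-elim zero    φ h = h _ refl
  ◇^-elim (suc i) {x} φ h s =
    ◇^-elim i (◇ φ) (λ u xRⁱu s◇ → s◇ (λ y uRy → h y (u , xRⁱu , uRy)))
      (subst (Sat F V x) (◇^-suc i φ) s)

  ◇≤-intro : ∀ {i} k {x} φ → i ≤ k → Sat F V x (◇^ i φ) → Sat F V x (◇≤ k φ)
  ◇≤-intro zero          φ z≤n s = s
  ◇≤-intro {i} (suc k) φ i≤1+k s with i ≟ suc k
  ... | yes refl = λ ¬disj → proj₂ ¬disj s
  ... | no  i≢1+k = λ ¬disj → proj₁ ¬disj (◇≤-intro k φ (≤-pred (≤∧≢⇒< i≤1+k i≢1+k)) s)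

  ◇≤-elim : ∀ k {x} φ → (∀ i → i ≤ k → ¬ Sat F V x (◇^ i φ)) → ¬ Sat F V x (◇≤ k φ)
  ◇≤-elim zero    φ h = h zero z≤n
  ◇≤-elim (suc k) φ h s = s (◇≤-elim k φ (λ i i≤k → h i (m≤n⇒m≤1+n i≤k)) , h (suc k) ≤-refl)

ptAx-valid : ∀ {m n} → m ≤ n → Log (𝓕 m (suc n)) (ptAx n)
ptAx-valid {m} {n} m≤n F inF V w s◇ = Sat-stable F V w (◇≤ n p) λ ¬s≤ →
  ◇^-elim F V (suc n) p
    (λ y wRy sp → ¬s≤ (◇≤-intro F V n p m≤n (◇^-intro F V m p (inF w y wRy) sp)))
    s◇
  where p = var 0

ptAx-refuted : ∀ (F : Frame) {k} (x t : Frame.W F) →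
               Rpow F (suc k) x t → (∀ i → i ≤ k → ¬ Rpow F i x t) → ¬ ValidIn F (ptAx k)
ptAx-refuted F {k} x t xRᵏ⁺¹t ¬xRⁱt valid =
  ◇≤-elim F V k p
    (λ i i≤k → ◇^-elim F V i p (λ y xRⁱy ¬¬y≡t → ¬¬y≡t (λ y≡t → ¬xRⁱt i i≤k (subst (Rpow F i x) y≡t xRⁱy))))
    (valid V x (◇^-intro F V (suc k) p xRᵏ⁺¹t (λ t≢t → t≢t refl)))
  where
  V : Valuation F
  V _ y = y ≡ t
  p = var 0

≤-suc-frame : Frame
≤-suc-frame = record { W = ℕ ; R = λ x y → y ≤ suc x }

≤-suc-Rpow-bound : ∀ i {x y} → Rpow ≤-suc-frame i x y → y ≤ i + x
≤-suc-Rpow-bound zero    refl               = ≤-refl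
≤-suc-Rpow-bound (suc i) (u , xRⁱu , y≤1+u) = ≤-trans y≤1+u (s≤s (≤-suc-Rpow-bound i xRⁱu))

≤-suc-Rpow-intro : ∀ i {x y} → y ≤ suc i + x → Rpow ≤-suc-frame (suc i) x y
≤-suc-Rpow-intro zero    y≤1+x = _ , refl , y≤1+x
≤-suc-Rpow-intro (suc i) y≤2+i+x = _ , ≤-suc-Rpow-intro i ≤-refl , y≤2+i+x

≤-suc-frame∈𝓕 : ∀ {m n} → n ≤ m → 𝓕 m n ≤-suc-frame
≤-suc-frame∈𝓕 {zero}  z≤n x y xR⁰y = xR⁰y
≤-suc-frame∈𝓕 {suc m} n≤1+m x y xRⁿy =
  ≤-suc-Rpow-intro m (≤-trans (≤-suc-Rpow-bound _ xRⁿy) (+-monoˡ-≤ x n≤1+m))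

n≤m⇒¬ptAx : ∀ {m n} k → n ≤ m → ¬ Log (𝓕 m n) (ptAx k)
n≤m⇒¬ptAx k n≤m valid =
  ptAx-refuted ≤-suc-frame 0 (suc k)
    (≤-suc-Rpow-intro k (≤-reflexive (cong suc (sym (+-identityʳ k)))))
    (λ i i≤k 0Rⁱ1+k → <⇒≱ (s≤s i≤k) (≤-trans (≤-suc-Rpow-bound i 0Rⁱ1+k) (≤-reflexive (+-identityʳ i))))
    (valid ≤-suc-frame (≤-suc-frame∈𝓕 n≤m))

chain-frame : ℕ → Frame
chain-frame j = record { W = ℕ ; R = λ x y → (y ≡ suc x) × (y ≤ suc j) }

module _ (j : ℕ) where
  chain-Rpow-target : ∀ i {x y} → Rpow (chain-frame j) i x y → y ≡ i + x
  chain-Rpow-target zero    refl                  = refl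
  chain-Rpow-target (suc i) (u , xRⁱu , y≡1+u , _) = trans y≡1+u (cong suc (chain-Rpow-target i xRⁱu))

  chain-Rpow-from-0 : ∀ i → i ≤ suc j → Rpow (chain-frame j) i 0 i
  chain-Rpow-from-0 zero    _      = refl
  chain-Rpow-from-0 (suc i) 1+i≤1+j = i , chain-Rpow-from-0 i (m≤n⇒m≤1+n (≤-pred 1+i≤1+j)) , refl , 1+i≤1+j

  chain-frame∈𝓕 : ∀ {m n} → suc j < n → 𝓕 m n (chain-frame j)
  chain-frame∈𝓕 {n = suc n} 2+j≤1+n x y (u , xRⁿu , y≡1+u , y≤1+j) = contradiction y≤1+j (<⇒≱ (begin-strict
    suc j         <⟨ 2+j≤1+n ⟩
    suc n         ≤⟨ m≤m+n (suc n) x ⟩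
    suc (n + x)   ≡⟨ sym (chain-Rpow-target (suc n) (u , xRⁿu , y≡1+u , y≤1+j)) ⟩
    y             ∎))
    where open ≤-Reasoning

  1+j<n⇒¬ptAx : ∀ {m n} → suc j < n → ¬ Log (𝓕 m n) (ptAx j)
  1+j<n⇒¬ptAx 1+j<n valid =
    ptAx-refuted (chain-frame j) 0 (suc j)
      (chain-Rpow-from-0 (suc j) ≤-refl)
      (λ i i≤j 0Rⁱ1+j → <⇒≢ (s≤s i≤j) (sym (trans (chain-Rpow-target i 0Rⁱ1+j) (+-identityʳ i))))
      (valid (chain-frame j) (chain-frame∈𝓕 1+j<n))

ptAx-least : ∀ {m n j} → Log (𝓕 m (suc n)) (ptAx j) → n ≤ j
ptAx-least {n = n} {j} valid with n ≤? j
... | yes n≤j = n≤j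
... | no  n≰j = ⊥-elim (1+j<n⇒¬ptAx j (s≤s (≰⇒> n≰j)) valid)

proposition14 : (m n : ℕ) →
    ((m < n → Pretransitive (Log (𝓕 m n)) × IsTr (Log (𝓕 m n)) (n ∸ 1))
    × (n ≤ m → ¬ Pretransitive (Log (𝓕 m n))))
proposition14 m n = pretransitive n , λ n≤m (k , valid) → n≤m⇒¬ptAx k n≤m valid
  where
  pretransitive : ∀ n → m < n → Pretransitive (Log (𝓕 m n)) × IsTr (Log (𝓕 m n)) (n ∸ 1)
  pretransitive (suc n) (s≤s m≤n) = (n , ptAx-valid m≤n) , ptAx-valid m≤n , λ j → ptAx-least
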